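{- Let $G$ be a bipartite graph with parts $A$ and $B$, each of size $m$. Let $X\subseteq A$ and $Y\subseteq B$ with $|X|\ge 1/(\epsilon p)$ and $|Y|\ge \epsilon^{1/3}m$. Suppose $\epsilon,p$ are such that every vertex in $X$ has degree between $(1-\epsilon)mp$ and $(1+\epsilon)mp$, and every pair of distinct vertices in $X$ has codegree at most $(1+\epsilon)mp^2$. Then $e(X,Y)\ge (1-3\epsilon^{1/3})|X||Y|p$.
   Context: $e(X,Y)$ is the number of edges of $G$ with one endpoint in $X$ and one in $Y$; the codegree of two vertices is the number of their common neighbours. The parameters $\epsilon,p$ are implicitly assumed small (e.g. in $(0,1/10)$).
   Formalization: The parameters ε and p are rational, and their smallness is read as both lying in $(0,1/10)$. -}

module Defs where

open import Data.Nat as ℕ using (ℕ)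
open import Data.Bool using (Bool; if_then_else_)
open import Data.Fin using (Fin)
open import Data.Fin.Subset using (Subset; _∩_; ∣_∣)
open import Data.Vec using (tabulate; lookup; sum)
open import Data.Integer using (+_)
open import Data.Rational using (ℚ; _/_; _*_)

-- A bipartite graph with parts A = Fin m and B = Fin m, given by its
-- (bi)adjacency relation: adj a b = true iff a ∈ A is adjacent to b ∈ B.
BipGraph : ℕ → Set
BipGraph m = Fin m → Fin m → Bool

N : ∀ {m} → BipGraph m → Fin m → Subset m
N G a = tabulate (G a)

deg : ∀ {m} → BipGraph m → Fin m → ℕ
deg G a = ∣ N G a ∣

codeg : ∀ {m} → BipGraph m → Fin m → Fin m → ℕ
codeg G a a' = ∣ N G a ∩ N G a' ∣

e : ∀ {m} → BipGraph m → Subset m → Subset m → ℕ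
e G X Y = sum (tabulate (λ a → if lookup X a then ∣ N G a ∩ Y ∣ else 0))

ℕ→ℚ : ℕ → ℚ
ℕ→ℚ n = (+ n) / 1

cube : ℚ → ℚ
cube x = x * x * x

module Submission where

-- Write x, y for the indicator functions of X ⊆ A and Y ⊆ B and, for b ∈ B,
-- d(b) = Σ_{a∈X} [ab ∈ G] for the number of neighbours of b in X.  The deviation
-- D = |X||Y|p − e(X,Y) equals Σ_{b∈Y} t(b) with t(b) = |X|p − d(b), so the
-- Cauchy–Schwarz inequality gives D² ≤ |Y|·S with S = Σ_{b∈B} t(b)² (when Y ≠ ∅).
-- Expanding, S = m(|X|p)² − 2|X|p·Σ_b d(b) + Σ_b d(b)², and double counting gives
-- Σ_b d(b) = Σ_{a∈X} deg(a) and Σ_b d(b)² = Σ_{a,a'∈X} codeg(a,a').  The degree and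
-- codegree hypotheses together with 1 ≤ εp|X| then bound S ≤ 5εm|X|²p², hence
-- D² ≤ 5εm|X|²|Y|p².  Cubing and using εm³ ≤ |Y|³ yields
-- D⁶ ≤ 125ε²(|X||Y|p)⁶ ≤ (27ε(|X||Y|p)³)², i.e. D³ ≤ 27ε(|X||Y|p)³, which is the
-- paper's bound D ≤ 3ε^{1/3}|X||Y|p with the cube root cleared.

open import Defs
open import Data.Nat using (ℕ)
open import Data.Fin using (Fin)
open import Data.Fin.Subset using (Subset; _∈_; ∣_∣)
open import Data.Integer using (+_)
open import Data.Rational using (ℚ; 0ℚ; 1ℚ; _≤_; _<_; _*_; _+_; _-_; _/_)
open import Relation.Binary.PropositionalEquality using (_≢_)
open import Data.Product using (_×_)

open import Data.Nat using (zero; suc)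
import Data.Nat as ℕ
open import Data.Fin using (zero; suc)
open import Data.Fin.Properties using () renaming (_≟_ to _≟ᶠ_)
open import Data.Fin.Subset using (_∩_)
open import Data.Bool using (Bool; true; false; _∧_; if_then_else_)
open import Data.Vec using ([]; _∷_; lookup; tabulate)
import Data.Vec as Vec
open import Data.Vec.Properties using (lookup∘tabulate; lookup-zipWith; lookup⇒[]=)
open import Data.Product using (proj₁; proj₂)
open import Data.Sum using (inj₁; inj₂)
open import Data.Empty using (⊥-elim)
open import Relation.Nullary using (Dec; yes; no)
open import Relation.Binary.PropositionalEquality
  using (_≡_; refl; sym; trans; cong; cong₂; subst; subst₂; module ≡-Reasoning)
import Data.Integer as ℤ
import Data.Integer.Properties as ℤ
open import Data.Rational using (-_; mkℚ; nonNegative; positive)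
open import Data.Rational.Properties
open import Data.Rational.Solver using (module +-*-Solver)
import Data.Nat.Coprimality as Coprime
open import Algebra.Bundles using (CommutativeRing)
open import Algebra.Properties.Semiring.Sum (CommutativeRing.semiring +-*-commutativeRing)
  using (sum; sum-cong-≗; ∑-distrib-+; ∑-comm; *-distribˡ-sum; *-distribʳ-sum)

open +-*-Solver

ℕ→ℚ-mkℚ : ∀ n → ℕ→ℚ n ≡ mkℚ (+ n) 0 (Coprime.sym (Coprime.1-coprimeTo n))
ℕ→ℚ-mkℚ n = normalize-coprime (Coprime.sym (Coprime.1-coprimeTo n))

ℕ→ℚ-suc : ∀ n → ℕ→ℚ (suc n) ≡ 1ℚ + ℕ→ℚ n
ℕ→ℚ-suc n rewrite ℕ→ℚ-mkℚ n = cong (_/ 1) (sym numerator)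
  where
  numerator : + 1 ℤ.* + 1 ℤ.+ + n ℤ.* + 1 ≡ + suc n
  numerator rewrite ℤ.*-identityʳ (+ n) = refl

ℕ→ℚ-+ : ∀ a b → ℕ→ℚ (a ℕ.+ b) ≡ ℕ→ℚ a + ℕ→ℚ b
ℕ→ℚ-+ zero b = sym (+-identityˡ (ℕ→ℚ b))
ℕ→ℚ-+ (suc a) b rewrite ℕ→ℚ-suc (a ℕ.+ b) | ℕ→ℚ-suc a | ℕ→ℚ-+ a b =
  sym (+-assoc 1ℚ (ℕ→ℚ a) (ℕ→ℚ b))

ℕ→ℚ-nonneg : ∀ n → 0ℚ ≤ ℕ→ℚ n
ℕ→ℚ-nonneg n = nonNegative⁻¹ (ℕ→ℚ n) {{normalize-nonNeg n 1}}

-- Polynomial inequalities are certified by exhibiting the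
-- difference of the two sides as a visibly nonnegative expression; the identity
-- itself is checked by the ring solver.

≤-from-difference : ∀ {a b} r → b - a ≡ r → 0ℚ ≤ r → a ≤ b
≤-from-difference {a} {b} r b-a≡r 0≤r = subst₂ _≤_ (+-identityʳ a) a+r≡b (+-monoʳ-≤ a 0≤r)
  where
  a+r≡b : a + r ≡ b
  a+r≡b = trans (cong (_+_ a) (sym b-a≡r)) (solve 2 (λ a b → a :+ (b :- a) := b) refl a b)

difference-nonneg : ∀ {a b} → a ≤ b → 0ℚ ≤ b - a
difference-nonneg {a} {b} a≤b = subst (_≤ b - a) (+-inverseʳ a) (+-monoˡ-≤ (- a) a≤b)

nonneg-+ : ∀ {a b} → 0ℚ ≤ a → 0ℚ ≤ b → 0ℚ ≤ a + b
nonneg-+ = +-mono-≤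

nonneg-* : ∀ {a b} → 0ℚ ≤ a → 0ℚ ≤ b → 0ℚ ≤ a * b
nonneg-* {a} {b} 0≤a 0≤b =
  nonNegative⁻¹ (a * b) {{nonNeg*nonNeg⇒nonNeg a {{nonNegative 0≤a}} b {{nonNegative 0≤b}}}}

square-nonneg : ∀ a → 0ℚ ≤ a * a
square-nonneg a with ≤-total 0ℚ a
... | inj₁ 0≤a = nonneg-* 0≤a 0≤a
... | inj₂ a≤0 = subst (0ℚ ≤_) (solve 1 (λ a → (:- a) :* (:- a) := a :* a) refl a) (nonneg-* 0≤-a 0≤-a)
  where
  0≤-a : 0ℚ ≤ - a
  0≤-a = neg-antimono-≤ a≤0

cube-nonneg : ∀ {a} → 0ℚ ≤ a → 0ℚ ≤ cube a
cube-nonneg 0≤a = nonneg-* (nonneg-* 0≤a 0≤a) 0≤a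

cube-mono : ∀ {a b} → 0ℚ ≤ a → a ≤ b → cube a ≤ cube b
cube-mono {a} {b} 0≤a a≤b = ≤-from-difference ((b - a) * (b * b + a * b + a * a))
  (solve 2 (λ a b → b :* b :* b :- a :* a :* a := (b :- a) :* (b :* b :+ a :* b :+ a :* a)) refl a b)
  (nonneg-* (difference-nonneg a≤b)
    (nonneg-+ (nonneg-+ (nonneg-* 0≤b 0≤b) (nonneg-* 0≤a 0≤b)) (nonneg-* 0≤a 0≤a)))
  where
  0≤b : 0ℚ ≤ b
  0≤b = ≤-trans 0≤a a≤b

≤-of-square-≤ : ∀ a b → 0ℚ ≤ b → a * a ≤ b * b → a ≤ b
≤-of-square-≤ a b 0≤b a²≤b² with a ≤? b
... | yes a≤b = a≤b
... | no a≰b = ⊥-elim (<-irrefl refl (<-≤-trans b²<a² a²≤b²))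
  where
  b<a : b < a
  b<a = ≰⇒> a≰b
  b²<a² : b * b < a * a
  b²<a² = ≤-<-trans (*-monoˡ-≤-nonNeg b {{nonNegative 0≤b}} (<⇒≤ b<a))
                    (*-monoˡ-<-pos a {{positive (≤-<-trans 0≤b b<a)}} b<a)

cube-≤-of-nonpos : ∀ {B D} → 0ℚ ≤ B → D ≤ 0ℚ → cube D ≤ B
cube-≤-of-nonpos {B} {D} 0≤B D≤0 = ≤-from-difference (B + cube (0ℚ - D))
  (solve 2 (λ B D → B :- D :* D :* D := B :+ (con 0ℚ :- D) :* (con 0ℚ :- D) :* (con 0ℚ :- D)) refl B D)
  (nonneg-+ 0≤B (cube-nonneg (difference-nonneg D≤0)))

cube-≤-of-sixth-power : ∀ {B D} → 0ℚ ≤ B → cube (D * D) ≤ B * B → cube D ≤ B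
cube-≤-of-sixth-power {B} {D} 0≤B D⁶≤B² = ≤-of-square-≤ (cube D) B 0≤B
  (subst (_≤ B * B) (solve 1 (λ D → (D :* D) :* (D :* D) :* (D :* D) := (D :* D :* D) :* (D :* D :* D)) refl D) D⁶≤B²)

sum-mono : ∀ {n} {f g : Fin n → ℚ} → (∀ i → f i ≤ g i) → sum f ≤ sum g
sum-mono {zero} f≤g = ≤-refl
sum-mono {suc n} f≤g = +-mono-≤ (f≤g zero) (sum-mono (λ i → f≤g (suc i)))

sum-const : ∀ n (c : ℚ) → sum {n} (λ _ → c) ≡ ℕ→ℚ n * c
sum-const zero c = sym (*-zeroˡ c)
sum-const (suc n) c rewrite sum-const n c | ℕ→ℚ-suc n =
  solve 2 (λ c k → c :+ k :* c := (con 1ℚ :+ k) :* c) refl c (ℕ→ℚ n)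

sum-− : ∀ {n} (f g : Fin n → ℚ) → sum (λ i → f i - g i) ≡ sum f - sum g
sum-− f g = begin
  sum (λ i → f i - g i)          ≡⟨ sum-cong-≗ (λ i → solve 2 (λ u v → u :- v := u :+ con (- 1ℚ) :* v) refl (f i) (g i)) ⟩
  sum (λ i → f i + - 1ℚ * g i)   ≡⟨ ∑-distrib-+ f (λ i → - 1ℚ * g i) ⟩
  sum f + sum (λ i → - 1ℚ * g i) ≡⟨ cong (_+_ (sum f)) (sym (*-distribˡ-sum (- 1ℚ) g)) ⟩
  sum f + - 1ℚ * sum g           ≡⟨ solve 2 (λ u v → u :+ con (- 1ℚ) :* v := u :- v) refl (sum f) (sum g) ⟩
  sum f - sum g                  ∎
  where open ≡-Reasoning

sum-* : ∀ {n} (f g : Fin n → ℚ) → sum f * sum g ≡ sum (λ i → sum (λ j → f i * g j))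
sum-* f g = trans (*-distribʳ-sum (sum g) f) (sum-cong-≗ (λ i → *-distribˡ-sum (f i) g))

δ : ∀ {n} → Fin n → Fin n → ℚ
δ zero zero = 1ℚ
δ zero (suc j) = 0ℚ
δ (suc i) zero = 0ℚ
δ (suc i) (suc j) = δ i j

δ-diag : ∀ {n} (i : Fin n) → δ i i ≡ 1ℚ
δ-diag zero = refl
δ-diag (suc i) = δ-diag i

δ-off : ∀ {n} (i j : Fin n) → i ≢ j → δ i j ≡ 0ℚ
δ-off zero zero i≢j = ⊥-elim (i≢j refl)
δ-off zero (suc j) i≢j = refl
δ-off (suc i) zero i≢j = refl
δ-off (suc i) (suc j) i≢j = δ-off i j (λ i≡j → i≢j (cong suc i≡j))

δ-nonneg : ∀ {n} (i j : Fin n) → 0ℚ ≤ δ i j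
δ-nonneg zero zero = ℕ→ℚ-nonneg 1
δ-nonneg zero (suc j) = ≤-refl
δ-nonneg (suc i) zero = ≤-refl
δ-nonneg (suc i) (suc j) = δ-nonneg i j

sum-δ : ∀ {n} (i : Fin n) (c : ℚ) → sum (λ j → δ i j * c) ≡ c
sum-δ {suc n} zero c = begin
  1ℚ * c + sum {n} (λ _ → 0ℚ * c) ≡⟨ cong₂ _+_ (*-identityˡ c) (sum-const n (0ℚ * c)) ⟩
  c + ℕ→ℚ n * (0ℚ * c)             ≡⟨ solve 2 (λ c k → c :+ k :* (con 0ℚ :* c) := c) refl c (ℕ→ℚ n) ⟩
  c                                ∎
  where open ≡-Reasoning
sum-δ {suc n} (suc i) c = trans (cong₂ _+_ (*-zeroˡ c) (sum-δ i c)) (+-identityˡ c)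

ind : Bool → ℚ
ind true = 1ℚ
ind false = 0ℚ

ind-∧ : ∀ u v → ind (u ∧ v) ≡ ind u * ind v
ind-∧ true v = sym (*-identityˡ (ind v))
ind-∧ false v = sym (*-zeroˡ (ind v))

ind-idem : ∀ u → ind u * ind u ≡ ind u
ind-idem true = *-identityˡ 1ℚ
ind-idem false = *-zeroˡ 0ℚ

ℕ→ℚ-if : ∀ u n → ℕ→ℚ (if u then n else 0) ≡ ind u * ℕ→ℚ n
ℕ→ℚ-if true n = sym (*-identityˡ (ℕ→ℚ n))
ℕ→ℚ-if false n = sym (*-zeroˡ (ℕ→ℚ n))

card-as-sum : ∀ {n} (S : Subset n) → ℕ→ℚ ∣ S ∣ ≡ sum (λ i → ind (lookup S i))
card-as-sum [] = refl
card-as-sum (true ∷ S) = trans (ℕ→ℚ-suc ∣ S ∣) (cong (_+_ 1ℚ) (card-as-sum S))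
card-as-sum (false ∷ S) = trans (card-as-sum S) (sym (+-identityˡ _))

card-∩-as-sum : ∀ {n} (f : Fin n → Bool) (S : Subset n) →
  ℕ→ℚ ∣ tabulate f ∩ S ∣ ≡ sum (λ i → ind (f i) * ind (lookup S i))
card-∩-as-sum f S = trans (card-as-sum (tabulate f ∩ S)) (sum-cong-≗ entry)
  where
  entry : ∀ i → ind (lookup (tabulate f ∩ S) i) ≡ ind (f i) * ind (lookup S i)
  entry i = trans (cong ind (trans (lookup-zipWith _∧_ i (tabulate f) S)
                                   (cong (_∧ lookup S i) (lookup∘tabulate f i))))
                  (ind-∧ (f i) (lookup S i))

vec-sum-as-sum : ∀ {n} (f : Fin n → ℕ) → ℕ→ℚ (Vec.sum (tabulate f)) ≡ sum (λ i → ℕ→ℚ (f i))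
vec-sum-as-sum {zero} f = refl
vec-sum-as-sum {suc n} f = trans (ℕ→ℚ-+ (f zero) (Vec.sum (tabulate (λ i → f (suc i)))))
                                 (cong (_+_ (ℕ→ℚ (f zero))) (vec-sum-as-sum (λ i → f (suc i))))

-- Cauchy–Schwarz for 0/1 weights, in the form W·D² ≤ W·(W·S) with W = Σ wᵢ,
-- D = Σ wᵢtᵢ and S = Σ tᵢ²: sum the pointwise inequality
-- 2DW·wt ≤ D²·w + W²·t² (which is (D − Wt)² ≥ 0 for w = 1).
cauchy-schwarz-indicator : ∀ {n} (w : Fin n → Bool) (t : Fin n → ℚ) →
  let W = sum (λ i → ind (w i))
      D = sum (λ i → ind (w i) * t i)
  in W * (D * D) ≤ W * (W * sum (λ i → t i * t i))
cauchy-schwarz-indicator w t = ≤-from-difference _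
  (solve 3 (λ W D S → W :* (W :* S) :- W :* (D :* D)
                   := (D :* D :* W :+ W :* W :* S) :- con (ℕ→ℚ 2) :* D :* W :* D) refl W D S)
  (difference-nonneg summed)
  where
  W D S : ℚ
  W = sum (λ i → ind (w i))
  D = sum (λ i → ind (w i) * t i)
  S = sum (λ i → t i * t i)
  pointwise : ∀ u (s : ℚ) → ℕ→ℚ 2 * D * W * (ind u * s) ≤ D * D * ind u + W * W * (s * s)
  pointwise true s = ≤-from-difference ((D - W * s) * (D - W * s))
    (solve 3 (λ D W s → (D :* D :* con 1ℚ :+ W :* W :* (s :* s)) :- con (ℕ→ℚ 2) :* D :* W :* (con 1ℚ :* s)
                     := (D :- W :* s) :* (D :- W :* s)) refl D W s)
    (square-nonneg (D - W * s))
  pointwise false s = ≤-from-difference ((W * s) * (W * s))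
    (solve 3 (λ D W s → (D :* D :* con 0ℚ :+ W :* W :* (s :* s)) :- con (ℕ→ℚ 2) :* D :* W :* (con 0ℚ :* s)
                     := (W :* s) :* (W :* s)) refl D W s)
    (square-nonneg (W * s))
  summed : ℕ→ℚ 2 * D * W * D ≤ D * D * W + W * W * S
  summed = subst₂ _≤_
    (sym (*-distribˡ-sum (ℕ→ℚ 2 * D * W) (λ i → ind (w i) * t i)))
    (trans (∑-distrib-+ (λ i → D * D * ind (w i)) (λ i → W * W * (t i * t i)))
           (cong₂ _+_ (sym (*-distribˡ-sum (D * D) (λ i → ind (w i))))
                      (sym (*-distribˡ-sum (W * W) (λ i → t i * t i)))))
    (sum-mono (λ i → pointwise (w i) (t i)))

-- The sum of squared deviations S = m(Xp)² − 2Xp·Σd + Σd² is at most 5εmX²p², given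
-- Σd ≥ X·(1−ε)mp, Σd² ≤ X²·(1+ε)mp² + X·(1+ε)mp and 1 ≤ εpX (which absorbs the
-- diagonal term X·(1+ε)mp).
squares-bound : ∀ {ε p X M Σd Σd²} → 0ℚ ≤ ε → ε ≤ 1ℚ → 0ℚ ≤ p → 0ℚ ≤ X → 0ℚ ≤ M →
  1ℚ ≤ ε * p * X →
  X * ((1ℚ - ε) * M * p) ≤ Σd →
  Σd² ≤ X * ((1ℚ + ε) * M * (p * p) * X) + X * ((1ℚ + ε) * M * p) →
  M * ((X * p) * (X * p)) - (ℕ→ℚ 2 * X * p) * Σd + Σd² ≤ ℕ→ℚ 5 * ε * M * X * X * p * p
squares-bound {ε} {p} {X} {M} {Σd} {Σd²} 0≤ε ε≤1 0≤p 0≤X 0≤M 1≤εpX Σd-lower Σd²-upper =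
  ≤-from-difference
    ((ℕ→ℚ 2 * X * p) * (Σd - X * ((1ℚ - ε) * M * p))
     + ((X * ((1ℚ + ε) * M * (p * p) * X) + X * ((1ℚ + ε) * M * p)) - Σd²)
     + (ε * p * X - 1ℚ) * (X * ((1ℚ + ε) * M * p))
     + (1ℚ - ε) * ε * M * X * X * p * p)
    (solve 6 (λ ε p X M s s² →
       con (ℕ→ℚ 5) :* ε :* M :* X :* X :* p :* p :- (M :* ((X :* p) :* (X :* p)) :- (con (ℕ→ℚ 2) :* X :* p) :* s :+ s²)
       := (con (ℕ→ℚ 2) :* X :* p) :* (s :- X :* ((con 1ℚ :- ε) :* M :* p))
          :+ ((X :* ((con 1ℚ :+ ε) :* M :* (p :* p) :* X) :+ X :* ((con 1ℚ :+ ε) :* M :* p)) :- s²)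
          :+ (ε :* p :* X :- con 1ℚ) :* (X :* ((con 1ℚ :+ ε) :* M :* p))
          :+ (con 1ℚ :- ε) :* ε :* M :* X :* X :* p :* p)
      refl ε p X M Σd Σd²)
    (nonneg-+ (nonneg-+ (nonneg-+ (nonneg-* (nonneg-* (nonneg-* (ℕ→ℚ-nonneg 2) 0≤X) 0≤p) (difference-nonneg Σd-lower))
                                   (difference-nonneg Σd²-upper))
                        (nonneg-* (difference-nonneg 1≤εpX) (nonneg-* 0≤X 0≤U)))
              (nonneg-* (nonneg-* (nonneg-* (nonneg-* (nonneg-* (nonneg-* (difference-nonneg ε≤1) 0≤ε) 0≤M) 0≤X) 0≤X) 0≤p) 0≤p))
  where
  0≤U : 0ℚ ≤ (1ℚ + ε) * M * p
  0≤U = nonneg-* (nonneg-* (nonneg-+ (ℕ→ℚ-nonneg 1) 0≤ε) 0≤M) 0≤p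

-- Cubing the resulting bound D² ≤ Y·5εmX²p² and using εm³ ≤ Y³ gives at most
-- the square of 27ε(XYp)³, since 125ε³m³Y³(Xp)⁶ ≤ 125ε²(XYp)⁶ ≤ 729ε²(XYp)⁶.
sixth-power-bound : ∀ {ε p X Y M} → 0ℚ ≤ ε → 0ℚ ≤ p → 0ℚ ≤ X → 0ℚ ≤ Y →
  ε * cube M ≤ cube Y →
  cube (Y * (ℕ→ℚ 5 * ε * M * X * X * p * p))
    ≤ ((+ 27) / 1 * ε * cube (X * Y * p)) * ((+ 27) / 1 * ε * cube (X * Y * p))
sixth-power-bound {ε} {p} {X} {Y} {M} 0≤ε 0≤p 0≤X 0≤Y εm³≤Y³ = ≤-from-difference
  (ℕ→ℚ 125 * (ε * ε) * (cube (X * p) * cube (X * p)) * cube Y * (cube Y - ε * cube M)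
   + ℕ→ℚ 604 * (ε * ε) * (cube (X * Y * p) * cube (X * Y * p)))
  (solve 5 (λ ε X Y p M →
      (con ((+ 27) / 1) :* ε :* ((X :* Y :* p) :* (X :* Y :* p) :* (X :* Y :* p)))
        :* (con ((+ 27) / 1) :* ε :* ((X :* Y :* p) :* (X :* Y :* p) :* (X :* Y :* p)))
      :- (Y :* (con (ℕ→ℚ 5) :* ε :* M :* X :* X :* p :* p)) :* (Y :* (con (ℕ→ℚ 5) :* ε :* M :* X :* X :* p :* p))
         :* (Y :* (con (ℕ→ℚ 5) :* ε :* M :* X :* X :* p :* p))
      := con (ℕ→ℚ 125) :* (ε :* ε) :* (((X :* p) :* (X :* p) :* (X :* p)) :* ((X :* p) :* (X :* p) :* (X :* p)))
           :* (Y :* Y :* Y) :* (Y :* Y :* Y :- ε :* (M :* M :* M))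
         :+ con (ℕ→ℚ 604) :* (ε :* ε)
           :* (((X :* Y :* p) :* (X :* Y :* p) :* (X :* Y :* p)) :* ((X :* Y :* p) :* (X :* Y :* p) :* (X :* Y :* p))))
    refl ε X Y p M)
  (nonneg-+ (nonneg-* (nonneg-* (nonneg-* (nonneg-* (ℕ→ℚ-nonneg 125) (square-nonneg ε)) (nonneg-* Xp³ Xp³))
                                (cube-nonneg 0≤Y))
                      (difference-nonneg εm³≤Y³))
            (nonneg-* (nonneg-* (ℕ→ℚ-nonneg 604) (square-nonneg ε)) (nonneg-* XYp³ XYp³)))
  where
  Xp³ : 0ℚ ≤ cube (X * p)
  Xp³ = cube-nonneg (nonneg-* 0≤X 0≤p)
  XYp³ : 0ℚ ≤ cube (X * Y * p)
  XYp³ = cube-nonneg (nonneg-* (nonneg-* 0≤X 0≤Y) 0≤p)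

module Counting {m : ℕ} (G : BipGraph m) (X Y : Subset m) (p : ℚ) where

  M #X #Y #E : ℚ
  M = ℕ→ℚ m
  #X = ℕ→ℚ ∣ X ∣
  #Y = ℕ→ℚ ∣ Y ∣
  #E = ℕ→ℚ (e G X Y)

  degree : Fin m → ℚ
  degree a = ℕ→ℚ (deg G a)

  codegree : Fin m → Fin m → ℚ
  codegree a a' = ℕ→ℚ (codeg G a a')

  x y : Fin m → ℚ
  x a = ind (lookup X a)
  y b = ind (lookup Y b)

  adj : Fin m → Fin m → ℚ
  adj a b = ind (G a b)

  degX : Fin m → ℚ
  degX b = sum (λ a → x a * adj a b)

  deviation : Fin m → ℚ
  deviation b = #X * p - degX b

  #X-as-sum : #X ≡ sum x
  #X-as-sum = card-as-sum X

  #Y-as-sum : #Y ≡ sum y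
  #Y-as-sum = card-as-sum Y

  degree-as-sum : ∀ a → degree a ≡ sum (adj a)
  degree-as-sum a = trans (card-as-sum (tabulate (G a)))
                          (sum-cong-≗ (λ b → cong ind (lookup∘tabulate (G a) b)))

  codegree-as-sum : ∀ a a' → codegree a a' ≡ sum (λ b → adj a b * adj a' b)
  codegree-as-sum a a' = trans (card-∩-as-sum (G a) (tabulate (G a')))
    (sum-cong-≗ (λ b → cong (λ u → adj a b * ind u) (lookup∘tabulate (G a') b)))

  #E-as-sum : #E ≡ sum (λ a → x a * sum (λ b → adj a b * y b))
  #E-as-sum = trans (vec-sum-as-sum (λ a → if lookup X a then ∣ N G a ∩ Y ∣ else 0))
    (sum-cong-≗ (λ a → trans (ℕ→ℚ-if (lookup X a) ∣ N G a ∩ Y ∣) (cong (x a *_) (card-∩-as-sum (G a) Y))))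

  codegree-self : ∀ a → codegree a a ≡ degree a
  codegree-self a = trans (codegree-as-sum a a)
    (trans (sum-cong-≗ (λ b → ind-idem (G a b))) (sym (degree-as-sum a)))

  deviation-as-sum : #X * #Y * p - #E ≡ sum (λ b → y b * deviation b)
  deviation-as-sum = sym (begin
    sum (λ b → y b * deviation b)
      ≡⟨ sum-cong-≗ (λ b → solve 4 (λ w X p d → w :* (X :* p :- d) := w :* (X :* p) :- w :* d) refl (y b) #X p (degX b)) ⟩
    sum (λ b → y b * (#X * p) - y b * degX b)
      ≡⟨ sum-− (λ b → y b * (#X * p)) (λ b → y b * degX b) ⟩
    sum (λ b → y b * (#X * p)) - sum (λ b → y b * degX b)
      ≡⟨ cong₂ _-_ (sym (*-distribʳ-sum (#X * p) y)) (sum-cong-≗ (λ b → *-distribˡ-sum (y b) (λ a → x a * adj a b))) ⟩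
    sum y * (#X * p) - sum (λ b → sum (λ a → y b * (x a * adj a b)))
      ≡⟨ cong (_-_ (sum y * (#X * p))) (sym (∑-comm (λ a b → y b * (x a * adj a b)))) ⟩
    sum y * (#X * p) - sum (λ a → sum (λ b → y b * (x a * adj a b)))
      ≡⟨ cong (_-_ (sum y * (#X * p))) (sum-cong-≗ (λ a → trans (sum-cong-≗ (λ b → reorder (y b) (x a) (adj a b)))
                                                            (sym (*-distribˡ-sum (x a) (λ b → adj a b * y b))))) ⟩
    sum y * (#X * p) - sum (λ a → x a * sum (λ b → adj a b * y b))
      ≡⟨ cong₂ (λ u v → u * (#X * p) - v) (sym #Y-as-sum) (sym #E-as-sum) ⟩
    #Y * (#X * p) - #E
      ≡⟨ cong (_- #E) (solve 3 (λ X Y p → Y :* (X :* p) := X :* Y :* p) refl #X #Y p) ⟩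
    #X * #Y * p - #E ∎)
    where
    open ≡-Reasoning
    reorder : ∀ u v w → u * (v * w) ≡ v * (w * u)
    reorder = solve 3 (λ u v w → u :* (v :* w) := v :* (w :* u)) refl

  squares-expansion : sum (λ b → deviation b * deviation b)
    ≡ M * ((#X * p) * (#X * p)) - (ℕ→ℚ 2 * #X * p) * sum degX + sum (λ b → degX b * degX b)
  squares-expansion = begin
    sum (λ b → deviation b * deviation b)
      ≡⟨ sum-cong-≗ (λ b → solve 2 (λ c d → (c :- d) :* (c :- d) := (c :* c :- (con (ℕ→ℚ 2) :* c) :* d) :+ d :* d) refl (#X * p) (degX b)) ⟩
    sum (λ b → ((#X * p) * (#X * p) - (ℕ→ℚ 2 * (#X * p)) * degX b) + degX b * degX b)
      ≡⟨ ∑-distrib-+ (λ b → (#X * p) * (#X * p) - (ℕ→ℚ 2 * (#X * p)) * degX b) (λ b → degX b * degX b) ⟩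
    sum (λ b → (#X * p) * (#X * p) - (ℕ→ℚ 2 * (#X * p)) * degX b) + sum (λ b → degX b * degX b)
      ≡⟨ cong (_+ sum (λ b → degX b * degX b)) (sum-− (λ _ → (#X * p) * (#X * p)) (λ b → (ℕ→ℚ 2 * (#X * p)) * degX b)) ⟩
    sum {m} (λ _ → (#X * p) * (#X * p)) - sum (λ b → (ℕ→ℚ 2 * (#X * p)) * degX b) + sum (λ b → degX b * degX b)
      ≡⟨ cong (λ u → u + sum (λ b → degX b * degX b))
              (cong₂ _-_ (sum-const m ((#X * p) * (#X * p))) (sym (*-distribˡ-sum (ℕ→ℚ 2 * (#X * p)) degX))) ⟩
    M * ((#X * p) * (#X * p)) - (ℕ→ℚ 2 * (#X * p)) * sum degX + sum (λ b → degX b * degX b)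
      ≡⟨ cong (λ c → M * ((#X * p) * (#X * p)) - c * sum degX + sum (λ b → degX b * degX b)) (sym (*-assoc (ℕ→ℚ 2) #X p)) ⟩
    M * ((#X * p) * (#X * p)) - (ℕ→ℚ 2 * #X * p) * sum degX + sum (λ b → degX b * degX b) ∎
    where open ≡-Reasoning

  handshake : sum degX ≡ sum (λ a → x a * degree a)
  handshake = trans (sym (∑-comm (λ a b → x a * adj a b)))
    (sum-cong-≗ (λ a → trans (sym (*-distribˡ-sum (x a) (adj a))) (cong (x a *_) (sym (degree-as-sum a)))))

  -- Σ_b d(b)² = Σ_{a,a'∈X} codeg(a,a'): both count triples (a, a', b) with b ~ a, a'.
  pair-count : sum (λ b → degX b * degX b) ≡ sum (λ a → sum (λ a' → x a * x a' * codegree a a'))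
  pair-count = begin
    sum (λ b → degX b * degX b)
      ≡⟨ sum-cong-≗ (λ b → sum-* (λ a → x a * adj a b) (λ a → x a * adj a b)) ⟩
    sum (λ b → sum (λ a → sum (λ a' → (x a * adj a b) * (x a' * adj a' b))))
      ≡⟨ sym (∑-comm (λ a b → sum (λ a' → (x a * adj a b) * (x a' * adj a' b)))) ⟩
    sum (λ a → sum (λ b → sum (λ a' → (x a * adj a b) * (x a' * adj a' b))))
      ≡⟨ sum-cong-≗ (λ a → ∑-comm (λ b a' → (x a * adj a b) * (x a' * adj a' b))) ⟩
    sum (λ a → sum (λ a' → sum (λ b → (x a * adj a b) * (x a' * adj a' b))))
      ≡⟨ sum-cong-≗ (λ a → sum-cong-≗ (λ a' → factor a a')) ⟩
    sum (λ a → sum (λ a' → x a * x a' * codegree a a')) ∎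
    where
    open ≡-Reasoning
    factor : ∀ a a' → sum (λ b → (x a * adj a b) * (x a' * adj a' b)) ≡ x a * x a' * codegree a a'
    factor a a' = begin
      sum (λ b → (x a * adj a b) * (x a' * adj a' b))
        ≡⟨ sum-cong-≗ (λ b → solve 4 (λ u u' v v' → (u :* v) :* (u' :* v') := u :* u' :* (v :* v')) refl (x a) (x a') (adj a b) (adj a' b)) ⟩
      sum (λ b → x a * x a' * (adj a b * adj a' b))
        ≡⟨ sym (*-distribˡ-sum (x a * x a') (λ b → adj a b * adj a' b)) ⟩
      x a * x a' * sum (λ b → adj a b * adj a' b)
        ≡⟨ cong (x a * x a' *_) (sym (codegree-as-sum a a')) ⟩
      x a * x a' * codegree a a' ∎

  degree-sum-lower : ∀ L → (∀ a → a ∈ X → L ≤ degree a) → #X * L ≤ sum (λ a → x a * degree a)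
  degree-sum-lower L L≤deg = subst (_≤ sum (λ a → x a * degree a))
    (trans (sym (*-distribʳ-sum L x)) (cong (_* L) (sym #X-as-sum)))
    (sum-mono pointwise)
    where
    pointwise : ∀ a → x a * L ≤ x a * degree a
    pointwise a with lookup X a in a∈X
    ... | true = *-monoˡ-≤-nonNeg 1ℚ (L≤deg a (lookup⇒[]= a X a∈X))
    ... | false = ≤-reflexive (trans (*-zeroˡ L) (sym (*-zeroˡ (degree a))))

  -- Upper bound on Σ_{a,a'∈X} codeg(a,a'): off-diagonal terms are codegrees, the
  -- diagonal terms are degrees.
  pair-sum-upper : ∀ U₁ U₂ → 0ℚ ≤ U₁ → 0ℚ ≤ U₂ →
    (∀ a → a ∈ X → degree a ≤ U₁) →
    (∀ a a' → a ∈ X → a' ∈ X → a ≢ a' → codegree a a' ≤ U₂) →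
    sum (λ a → sum (λ a' → x a * x a' * codegree a a')) ≤ #X * (U₂ * #X) + #X * U₁
  pair-sum-upper U₁ U₂ 0≤U₁ 0≤U₂ deg≤ codeg≤ =
    ≤-trans (sum-mono (λ a → sum-mono (λ a' → pointwise a a'))) (≤-reflexive total)
    where
    pointwise : ∀ a a' → x a * x a' * codegree a a' ≤ (x a * U₂) * x a' + δ a a' * (x a * U₁)
    pointwise a a' with lookup X a in a∈X | lookup X a' in a'∈X
    ... | false | u' = ≤-reflexive
      (solve 5 (λ w c u₁ u₂ d → con 0ℚ :* w :* c := (con 0ℚ :* u₂) :* w :+ d :* (con 0ℚ :* u₁))
             refl (ind u') (codegree a a') U₁ U₂ (δ a a'))
    ... | true | false = ≤-from-difference (δ a a' * U₁)
      (solve 4 (λ c u₁ u₂ d → ((con 1ℚ :* u₂) :* con 0ℚ :+ d :* (con 1ℚ :* u₁)) :- con 1ℚ :* con 0ℚ :* c := d :* u₁)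
             refl (codegree a a') U₁ U₂ (δ a a'))
      (nonneg-* (δ-nonneg a a') 0≤U₁)
    ... | true | true with a ≟ᶠ a'
    ...   | yes refl rewrite δ-diag a | codegree-self a = ≤-from-difference (U₂ + (U₁ - degree a))
      (solve 3 (λ c u₁ u₂ → ((con 1ℚ :* u₂) :* con 1ℚ :+ con 1ℚ :* (con 1ℚ :* u₁)) :- con 1ℚ :* con 1ℚ :* c := u₂ :+ (u₁ :- c))
             refl (degree a) U₁ U₂)
      (nonneg-+ 0≤U₂ (difference-nonneg (deg≤ a (lookup⇒[]= a X a∈X))))
    ...   | no a≢a' rewrite δ-off a a' a≢a' = ≤-from-difference (U₂ - codegree a a')
      (solve 3 (λ c u₁ u₂ → ((con 1ℚ :* u₂) :* con 1ℚ :+ con 0ℚ :* (con 1ℚ :* u₁)) :- con 1ℚ :* con 1ℚ :* c := u₂ :- c)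
             refl (codegree a a') U₁ U₂)
      (difference-nonneg (codeg≤ a a' (lookup⇒[]= a X a∈X) (lookup⇒[]= a' X a'∈X) a≢a'))
    total : sum (λ a → sum (λ a' → (x a * U₂) * x a' + δ a a' * (x a * U₁))) ≡ #X * (U₂ * #X) + #X * U₁
    total = begin
      sum (λ a → sum (λ a' → (x a * U₂) * x a' + δ a a' * (x a * U₁)))
        ≡⟨ sum-cong-≗ (λ a → trans (∑-distrib-+ (λ a' → (x a * U₂) * x a') (λ a' → δ a a' * (x a * U₁)))
                                   (cong₂ _+_ (sym (*-distribˡ-sum (x a * U₂) x)) (sum-δ a (x a * U₁)))) ⟩
      sum (λ a → (x a * U₂) * sum x + x a * U₁)
        ≡⟨ ∑-distrib-+ (λ a → (x a * U₂) * sum x) (λ a → x a * U₁) ⟩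
      sum (λ a → (x a * U₂) * sum x) + sum (λ a → x a * U₁)
        ≡⟨ cong₂ _+_ (trans (sum-cong-≗ (λ a → *-assoc (x a) U₂ (sum x))) (sym (*-distribʳ-sum (U₂ * sum x) x)))
                     (sym (*-distribʳ-sum U₁ x)) ⟩
      sum x * (U₂ * sum x) + sum x * U₁
        ≡⟨ cong (λ s → s * (U₂ * s) + s * U₁) (sym #X-as-sum) ⟩
      #X * (U₂ * #X) + #X * U₁ ∎
      where open ≡-Reasoning

  deviation-bound : ∀ ε → 0ℚ ≤ ε → ε ≤ 1ℚ → 0ℚ ≤ p →
    1ℚ ≤ ε * p * #X → ε * cube M ≤ cube #Y →
    (∀ a → a ∈ X → (1ℚ - ε) * M * p ≤ degree a) →
    (∀ a → a ∈ X → degree a ≤ (1ℚ + ε) * M * p) →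
    (∀ a a' → a ∈ X → a' ∈ X → a ≢ a' → codegree a a' ≤ (1ℚ + ε) * M * (p * p)) →
    cube (#X * #Y * p - #E) ≤ (+ 27) / 1 * ε * cube (#X * #Y * p)
  deviation-bound ε 0≤ε ε≤1 0≤p 1≤εpX εm³≤Y³ deg≥ deg≤ codeg≤ = by-size-of-Y (#Y ≤? 0ℚ)
    where
    0≤X : 0ℚ ≤ #X
    0≤X = ℕ→ℚ-nonneg ∣ X ∣
    0≤Y : 0ℚ ≤ #Y
    0≤Y = ℕ→ℚ-nonneg ∣ Y ∣
    B D Q S U₁ U₂ : ℚ
    B = (+ 27) / 1 * ε * cube (#X * #Y * p)
    0≤B : 0ℚ ≤ B
    0≤B = nonneg-* (nonneg-* (ℕ→ℚ-nonneg 27) 0≤ε) (cube-nonneg (nonneg-* (nonneg-* 0≤X 0≤Y) 0≤p))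
    D = #X * #Y * p - #E
    Q = ℕ→ℚ 5 * ε * M * #X * #X * p * p
    S = sum (λ b → deviation b * deviation b)
    U₁ = (1ℚ + ε) * M * p
    U₂ = (1ℚ + ε) * M * (p * p)
    0≤U₁ : 0ℚ ≤ U₁
    0≤U₁ = nonneg-* (nonneg-* (nonneg-+ (ℕ→ℚ-nonneg 1) 0≤ε) (ℕ→ℚ-nonneg m)) 0≤p
    0≤U₂ : 0ℚ ≤ U₂
    0≤U₂ = nonneg-* (nonneg-* (nonneg-+ (ℕ→ℚ-nonneg 1) 0≤ε) (ℕ→ℚ-nonneg m)) (nonneg-* 0≤p 0≤p)
    S≤Q : S ≤ Q
    S≤Q = subst (_≤ Q) (sym squares-expansion)
      (squares-bound 0≤ε ε≤1 0≤p 0≤X (ℕ→ℚ-nonneg m) 1≤εpX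
        (subst (#X * ((1ℚ - ε) * M * p) ≤_) (sym handshake) (degree-sum-lower _ deg≥))
        (subst (_≤ #X * (U₂ * #X) + #X * U₁) (sym pair-count) (pair-sum-upper U₁ U₂ 0≤U₁ 0≤U₂ deg≤ codeg≤)))
    YD²≤Y²S : #Y * (D * D) ≤ #Y * (#Y * S)
    YD²≤Y²S = subst₂ (λ W D′ → W * (D′ * D′) ≤ W * (W * S)) (sym #Y-as-sum) (sym deviation-as-sum)
      (cauchy-schwarz-indicator (lookup Y) deviation)
    D²≤YQ : 0ℚ < #Y → D * D ≤ #Y * Q
    D²≤YQ 0<Y = *-cancelˡ-≤-pos #Y {{positive 0<Y}}
      (≤-trans YD²≤Y²S (*-monoˡ-≤-nonNeg #Y {{nonNegative 0≤Y}} (*-monoˡ-≤-nonNeg #Y {{nonNegative 0≤Y}} S≤Q)))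
    -- For Y = ∅ the deviation is −e(X,Y) ≤ 0; otherwise cube the bound on D².
    by-size-of-Y : Dec (#Y ≤ 0ℚ) → cube D ≤ B
    by-size-of-Y (yes Y≤0) = cube-≤-of-nonpos {B} {D} 0≤B (≤-from-difference (#E + #X * p * (0ℚ - #Y))
      (solve 4 (λ X Y p E → con 0ℚ :- (X :* Y :* p :- E) := E :+ X :* p :* (con 0ℚ :- Y)) refl #X #Y p #E)
      (nonneg-+ (ℕ→ℚ-nonneg (e G X Y)) (nonneg-* (nonneg-* 0≤X 0≤p) (difference-nonneg Y≤0))))
    by-size-of-Y (no Y≰0) = cube-≤-of-sixth-power {B} {D} 0≤B
      (≤-trans (cube-mono (square-nonneg D) (D²≤YQ (≰⇒> Y≰0))) (sixth-power-bound 0≤ε 0≤p 0≤X 0≤Y εm³≤Y³))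

lemma3p2 : (ε p : ℚ) → 0ℚ < ε → ε < (+ 1) / 10 → 0ℚ < p → p < (+ 1) / 10 →
    (m : ℕ) (G : BipGraph m) (X Y : Subset m) →
    1ℚ ≤ ε * p * ℕ→ℚ ∣ X ∣ →
    ε * cube (ℕ→ℚ m) ≤ cube (ℕ→ℚ ∣ Y ∣) →
    (∀ a → a ∈ X → ((1ℚ - ε) * ℕ→ℚ m * p ≤ ℕ→ℚ (deg G a)) × (ℕ→ℚ (deg G a) ≤ (1ℚ + ε) * ℕ→ℚ m * p)) →
    (∀ a a' → a ∈ X → a' ∈ X → a ≢ a' → ℕ→ℚ (codeg G a a') ≤ (1ℚ + ε) * ℕ→ℚ m * (p * p)) →
    cube (ℕ→ℚ ∣ X ∣ * ℕ→ℚ ∣ Y ∣ * p - ℕ→ℚ (e G X Y))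
      ≤ ((+ 27) / 1) * ε * cube (ℕ→ℚ ∣ X ∣ * ℕ→ℚ ∣ Y ∣ * p)
lemma3p2 ε p 0<ε ε<⅒ 0<p _ m G X Y 1≤εpX εm³≤Y³ degree-bounds codeg≤ =
  Counting.deviation-bound G X Y p ε (<⇒≤ 0<ε) ε≤1 (<⇒≤ 0<p) 1≤εpX εm³≤Y³
    (λ a a∈X → proj₁ (degree-bounds a a∈X)) (λ a a∈X → proj₂ (degree-bounds a a∈X)) codeg≤
  where
  -- only ε ≤ 1 is needed (for (1 − ε)ε ≥ 0 in squares-bound)
  ε≤1 : ε ≤ 1ℚ
  ε≤1 = ≤-trans (<⇒≤ ε<⅒) (≤-from-difference ((+ 9) / 10) refl (nonNegative⁻¹ ((+ 9) / 10) {{normalize-nonNeg 9 10}}))
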